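{- Let $F_1,F_2$ be forests on the node set $[n]$, let $F_1^2$ be the forest obtained from $F_1$ by applying Step 1 and then Step 2, and let $\textsc{ALG}(3)$ be the number of cut operations performed by Step 3 on $F_1^2$. Then $\textsc{ALG}(3)\le 2\tilde d(F_1^2,F_2)$.
   Context: Nodes are labelled by distinct labels from $[n]$ and identified with them; $p_F(u)$ is the parent of $u$ in $F$, $\bot$ if $u$ is a root. For the current forest $F$, let $a[i]=p_F(i)$ if not $\bot$ and $a[i]=0$ otherwise, and $b[i]=p_{F_2}(i)$ if not $\bot$ and $0$ otherwise. Step 1 (applied to $F_1$): for every $i$ with $a[i],b[i]\neq0$ and $a[i]\neq b[i]$, remove the edges from $a[i]$ and from $b[i]$ to their parents (if any); the result is $F_1^1$. Step 2 (applied to $F_1^1$): for each $u\in[n]$ with children $v_1,\dots,v_k$ in $F_1^1$, let $B(u)=\{b[v_i]:b[v_i]\neq0\}$ (multiset) and remove every edge $(v_i,u)$ with $b[v_i]\neq0$ and $b[v_i]\neq\mathsf{mode}(B(u))$, where $\mathsf{mode}$ is an element of largest multiplicity (ties arbitrary); the result is $F_1^2$. Step 3 (applied to $F_1^2$): for each $u\in[n]$ with children $v_1,\dots,v_k$ in $F_2$, let $B'(u)=\{a[v_i]:a[v_i]\neq0\}$ (multiset, $a$ taken in $F_1^2$) and remove every edge $(v_i,a[v_i])$ with $a[v_i]\neq0$ and $a[v_i]\neq\mathsf{mode}(B'(u))$ (ties arbitrary). Operations: (cut) removing an edge from a node to its parent; (permutation) apply a permutation $\pi$ of $[n]$, so $\pi(u)$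 becomes a child of $\pi(v)$ whenever $u$ was a child of $v$. The size of a sequence is the number of cuts plus the sum over permutations $\pi$ of $|\{x:\pi(x)\neq x\}|$. Write $F\sim F'$ if for every $u$: $p_F(u)=p_{F'}(u)$ or $p_F(u)=\bot$ or $p_{F'}(u)=\bot$. $\tilde d(F,F_2)$ is the minimum size of a sequence of cut and permutation operations transforming $F$ into some $F'$ with $F'\sim F_2$. -}

module Defs where

open import Data.Nat using (ℕ; zero; suc; _+_; _≤_)
open import Data.Bool using (Bool; true; false; _∧_; _∨_; not; if_then_else_; T)
open import Data.Bool.Properties using (T?)
open import Data.Fin using (Fin; _≟_)
open import Data.Maybe using (Maybe; just; nothing; _>>=_)
import Data.Maybe as M
open import Data.Maybe.Properties using (≡-dec)
open import Data.List using (List; filter; length; allFin)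
open import Data.Bool.ListAction using (any)
open import Data.Fin.Permutation using (Permutation′; _⟨$⟩ʳ_; _⟨$⟩ˡ_)
open import Data.Product using (Σ; _×_)
open import Data.Sum using (_⊎_)
open import Relation.Nullary.Decidable using (⌊_⌋)
open import Relation.Binary.PropositionalEquality using (_≡_)

-- A (rooted) forest on the node set [n] = Fin n, given by its parent map:
-- p u = just v  means v is the parent of u;  p u = nothing  means u is a root (⊥).
Parent : ℕ → Set
Parent n = Fin n → Maybe (Fin n)

anc : ∀ {n} → Parent n → ℕ → Fin n → Maybe (Fin n)
anc p zero    u = just u
anc p (suc k) u = anc p k u >>= p

-- Acyclicity: following parent pointers n times from any node leaves the forest.
IsForest : ∀ {n} → Parent n → Set
IsForest {n} p = ∀ u → anc p n u ≡ nothing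

eqF : ∀ {n} → Fin n → Fin n → Bool
eqF x y = ⌊ x ≟ y ⌋

eqM : ∀ {n} → Maybe (Fin n) → Maybe (Fin n) → Bool
eqM a b = ⌊ ≡-dec _≟_ a b ⌋

countB : ∀ {n} → (Fin n → Bool) → ℕ
countB {n} f = length (filter (λ i → T? (f i)) (allFin n))

-- Step 1 (a = parent in F₁, b = parent in F₂)

isBad : ∀ {n} → Maybe (Fin n) → Maybe (Fin n) → Bool
isBad (just x) (just y) = not (eqF x y)
isBad _        _        = false

cut1 : ∀ {n} → Parent n → Parent n → Fin n → Bool
cut1 {n} a b x =
  any (λ i → isBad (a i) (b i) ∧ (eqM (a i) (just x) ∨ eqM (b i) (just x))) (allFin n)

step1 : ∀ {n} → Parent n → Parent n → Parent n
step1 a b x = if cut1 a b x then nothing else a x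

-- Step 2 (applied to F₁¹ = p1; b = parent in F₂); mode choice m : u ↦ mode(B(u))

-- multiplicity of w in B(u): number of children v of u in p1 with b[v] = w
cnt2 : ∀ {n} → Parent n → Parent n → Fin n → Fin n → ℕ
cnt2 p1 b u w = countB (λ v → eqM (p1 v) (just u) ∧ eqM (b v) (just w))

-- m u is an element of largest multiplicity of B(u) (any tie-breaking allowed)
IsMode2 : ∀ {n} → Parent n → Parent n → (Fin n → Fin n) → Set
IsMode2 p1 b m = ∀ u w → cnt2 p1 b u w ≤ cnt2 p1 b u (m u)

keep2 : ∀ {n} → Fin n → Maybe (Fin n) → (Fin n → Fin n) → Maybe (Fin n)
keep2 u nothing  m = just u
keep2 u (just w) m = if eqF w (m u) then just u else nothing

step2 : ∀ {n} → Parent n → Parent n → (Fin n → Fin n) → Parent n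
step2 p1 b m v with p1 v
... | nothing = nothing
... | just u  = keep2 u (b v) m

F1² : ∀ {n} → Parent n → Parent n → (Fin n → Fin n) → Parent n
F1² a b m = step2 (step1 a b) b m

-- Step 3 (applied to p2 = F₁²; a taken in p2, b = parent in F₂)

-- multiplicity of w in B'(u): number of children v of u in F₂ with a[v] = w
cnt3 : ∀ {n} → Parent n → Parent n → Fin n → Fin n → ℕ
cnt3 p2 b u w = countB (λ v → eqM (b v) (just u) ∧ eqM (p2 v) (just w))

IsMode3 : ∀ {n} → Parent n → Parent n → (Fin n → Fin n) → Set
IsMode3 p2 b m = ∀ u w → cnt3 p2 b u w ≤ cnt3 p2 b u (m u)

cut3 : ∀ {n} → Parent n → Parent n → (Fin n → Fin n) → Fin n → Bool
cut3 p2 b m v with b v | p2 v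
... | just u | just w = not (eqF w (m u))
... | _      | _      = false

ALG3 : ∀ {n} → Parent n → Parent n → (Fin n → Fin n) → ℕ
ALG3 p2 b m = countB (cut3 p2 b m)

cutAt : ∀ {n} → Parent n → Fin n → Parent n
cutAt p x v = if eqF v x then nothing else p v

-- π(u) becomes a child of π(v) whenever u was a child of v
permute : ∀ {n} → Permutation′ n → Parent n → Parent n
permute π p v = M.map (π ⟨$⟩ʳ_) (p (π ⟨$⟩ˡ v))

permCost : ∀ {n} → Permutation′ n → ℕ
permCost π = countB (λ x → not (eqF (π ⟨$⟩ʳ x) x))

data Reach {n : ℕ} : Parent n → ℕ → Parent n → Set where
  done : ∀ {p} → Reach p 0 p
  cut  : ∀ {p s r} (x y : Fin n) → p x ≡ just y →
         Reach (cutAt p x) s r → Reach p (suc s) r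
  perm : ∀ {p s r} (π : Permutation′ n) →
         Reach (permute π p) s r → Reach p (permCost π + s) r

_∼_ : ∀ {n} → Parent n → Parent n → Set
F ∼ F' = ∀ u → (F u ≡ F' u) ⊎ ((F u ≡ nothing) ⊎ (F' u ≡ nothing))

IsDtilde : ∀ {n} → Parent n → Parent n → ℕ → Set
IsDtilde {n} F F₂ d =
  Σ (Parent n) (λ F' → Reach F d F' × F' ∼ F₂) ×
  (∀ s (F' : Parent n) → Reach F s F' → F' ∼ F₂ → d ≤ s)

module Submission where

-- We prove the stronger bound ALG(3) ≤ d̃(F₁², F₂); the factor 2 is then free.
--
-- 1. Simulation.  If a sequence of operations of size s turns p into r, then
--    there is a relabelling σ (the composite of the permutations used) such
--    that r v = σ(p v) for all but at most s nodes v, the "mismatches": a cut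
--    spoils at most the cut node, a permutation π at most the nodes it moves.
-- 2. Counting per F₂-parent.  Fix u and compare with an r ∼ F₂.  A child v of
--    u in F₂ that has a p-parent and is not a mismatch has r-parent σ(p v),
--    which must be u; so all such children share the p-parent σ⁻¹(u).  Since
--    Step 3 keeps exactly the children whose p-parent is the mode, and the mode
--    is at least as frequent as σ⁻¹(u), the children of u cut by Step 3 are at
--    most as many as the mismatched children of u.
-- 3. Summing over u (double counting by F₂-parent) bounds ALG(3) by the number
--    of mismatches, hence by s.

open import Defs
open import Data.Bool using (Bool; true; false; _∧_; not; T)
open import Data.Bool.Properties using (T?; T-∧; ∧-identityʳ)
open import Function.Bundles using (Equivalence)
open import Data.Empty using (⊥-elim)
open import Data.Fin using (Fin; zero; suc; _≟_)
open import Data.Fin.Permutation using (Permutation′; _⟨$⟩ʳ_; _⟨$⟩ˡ_; id; _∘ₚ_; inverseˡ)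
open import Data.List using (length; filter; tabulate)
open import Data.Maybe using (Maybe; just; nothing; maybe′; is-just)
import Data.Maybe as Maybe
open import Data.Maybe.Properties using (≡-dec; just-injective; map-id; map-∘)
open import Data.Nat using (ℕ; zero; suc; _+_; _*_; _≤_; z≤n; s≤s)
open import Data.Nat.Properties
  using (≤-refl; ≤-trans; ≤-reflexive; +-mono-≤; +-monoˡ-≤; +-comm; +-identityʳ; +-cancelʳ-≤; m≤m+n; +-0-commutativeMonoid; module ≤-Reasoning)
open import Algebra.Properties.CommutativeMonoid.Sum +-0-commutativeMonoid
  using (sum; sum-syntax; ∑-comm; ∑-distrib-+; sum-cong-≗; sum-replicate-zero)
open import Data.Product using (Σ-syntax; _,_)
open import Data.Sum using (_⊎_; inj₁; inj₂)
open import Relation.Binary.PropositionalEquality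
  using (_≡_; refl; sym; trans; cong; cong₂; subst₂; module ≡-Reasoning)
open import Relation.Nullary using (¬_; yes; no)
open import Relation.Nullary.Decidable
  using (toWitness; fromWitness; toWitnessFalse; fromWitnessFalse; decidable-stable)

𝟙 : Bool → ℕ
𝟙 true  = 1
𝟙 false = 0

countB-sum : ∀ {n} (f : Fin n → Bool) → countB f ≡ ∑[ v < n ] 𝟙 (f v)
countB-sum {n} f = count-tabulate (λ v → v)
  where
  count-tabulate : ∀ {m} (g : Fin m → Fin n) →
                   length (filter (λ v → T? (f v)) (tabulate g)) ≡ ∑[ i < m ] 𝟙 (f (g i))
  count-tabulate {zero}  g = refl
  count-tabulate {suc m} g with f (g zero)
  ... | true  = cong suc (count-tabulate (λ i → g (suc i)))
  ... | false = count-tabulate (λ i → g (suc i))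

∑-mono : ∀ {n} {f g : Fin n → ℕ} → (∀ i → f i ≤ g i) → sum f ≤ sum g
∑-mono {zero}  f≤g = z≤n
∑-mono {suc n} f≤g = +-mono-≤ (f≤g zero) (∑-mono (λ i → f≤g (suc i)))

eqF-suc : ∀ {n} (x u : Fin n) → eqF (suc x) (suc u) ≡ eqF x u
eqF-suc x u with x ≟ u
... | yes _ = refl
... | no  _ = refl

eqM-just : ∀ {n} (x u : Fin n) → eqM (just x) (just u) ≡ eqF x u
eqM-just x u with x ≟ u
... | yes _ = refl
... | no  _ = refl

∑-delta : ∀ {n} (x : Fin n) (h : Fin n → Bool) → ∑[ u < n ] 𝟙 (eqF x u ∧ h u) ≡ 𝟙 (h x)
∑-delta {suc n} zero    h = trans (cong (𝟙 (h zero) +_) (sum-replicate-zero n)) (+-identityʳ _)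
∑-delta {suc n} (suc x) h =
  trans (sum-cong-≗ (λ u → cong (λ e → 𝟙 (e ∧ h (suc u))) (eqF-suc x u))) (∑-delta x (λ u → h (suc u)))

countB-cong : ∀ {n} {f g : Fin n → Bool} → (∀ v → f v ≡ g v) → countB f ≡ countB g
countB-cong {f = f} {g} f≗g =
  trans (countB-sum f) (trans (sum-cong-≗ (λ v → cong 𝟙 (f≗g v))) (sym (countB-sum g)))

countB-mono : ∀ {n} {f g : Fin n → Bool} → (∀ v → T (f v) → T (g v)) → countB f ≤ countB g
countB-mono {f = f} {g} f⇒g =
  subst₂ _≤_ (sym (countB-sum f)) (sym (countB-sum g)) (∑-mono (λ v → 𝟙-mono (f v) (g v) (f⇒g v)))
  where
  𝟙-mono : ∀ a b → (T a → T b) → 𝟙 a ≤ 𝟙 b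
  𝟙-mono false _     _   = z≤n
  𝟙-mono true  true  _   = ≤-refl
  𝟙-mono true  false a⇒b = ⊥-elim (a⇒b _)

countB-cover : ∀ {n} {f g h : Fin n → Bool} → (∀ v → T (f v) → T (g v) ⊎ T (h v)) →
               countB f ≤ countB g + countB h
countB-cover {n} {f} {g} {h} cover = begin
  countB f                        ≡⟨ countB-sum f ⟩
  ∑[ v < n ] 𝟙 (f v)              ≤⟨ ∑-mono (λ v → 𝟙-cover (f v) (g v) (h v) (cover v)) ⟩
  ∑[ v < n ] (𝟙 (g v) + 𝟙 (h v))  ≡⟨ ∑-distrib-+ (λ v → 𝟙 (g v)) (λ v → 𝟙 (h v)) ⟩
  sum (λ v → 𝟙 (g v)) + sum (λ v → 𝟙 (h v))
    ≡⟨ sym (cong₂ _+_ (countB-sum g) (countB-sum h)) ⟩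
  countB g + countB h             ∎
  where
  open ≤-Reasoning
  𝟙-cover : ∀ a b c → (T a → T b ⊎ T c) → 𝟙 a ≤ 𝟙 b + 𝟙 c
  𝟙-cover false _     _     _ = z≤n
  𝟙-cover true  true  _     _ = s≤s z≤n
  𝟙-cover true  false true  _ = s≤s z≤n
  𝟙-cover true  false false a⇒b∨c with a⇒b∨c _
  ... | inj₁ ()
  ... | inj₂ ()

countB-disjoint : ∀ {n} {f g h : Fin n → Bool} → (∀ v → 𝟙 (f v) + 𝟙 (g v) ≡ 𝟙 (h v)) →
                  countB f + countB g ≡ countB h
countB-disjoint {n} {f} {g} {h} split = begin
  countB f + countB g                        ≡⟨ cong (_+ countB g) (countB-sum f) ⟩
  sum (λ v → 𝟙 (f v)) + countB g             ≡⟨ cong (sum (λ v → 𝟙 (f v)) +_) (countB-sum g) ⟩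
  sum (λ v → 𝟙 (f v)) + sum (λ v → 𝟙 (g v))  ≡⟨ sym (∑-distrib-+ (λ v → 𝟙 (f v)) (λ v → 𝟙 (g v))) ⟩
  ∑[ v < n ] (𝟙 (f v) + 𝟙 (g v))             ≡⟨ sum-cong-≗ split ⟩
  ∑[ v < n ] 𝟙 (h v)                         ≡⟨ sym (countB-sum h) ⟩
  countB h                                   ∎
  where open ≡-Reasoning

countB-single : ∀ {n} (x : Fin n) → countB (eqF x) ≡ 1
countB-single x =
  trans (countB-sum (eqF x)) (trans (sum-cong-≗ (λ u → cong 𝟙 (sym (∧-identityʳ (eqF x u))))) (∑-delta x (λ _ → true)))

countB-fibres : ∀ {n} (q : Parent n) (g : Fin n → Fin n → Bool) →
                countB (λ v → maybe′ (λ u → g u v) false (q v)) ≡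
                ∑[ u < n ] countB (λ v → eqM (q v) (just u) ∧ g u v)
countB-fibres {n} q g = begin
  countB (λ v → maybe′ (λ u → g u v) false (q v))           ≡⟨ countB-sum (λ v → maybe′ (λ u → g u v) false (q v)) ⟩
  ∑[ v < n ] 𝟙 (maybe′ (λ u → g u v) false (q v))           ≡⟨ sum-cong-≗ (λ v → fibre v (q v)) ⟩
  ∑[ v < n ] ∑[ u < n ] 𝟙 (eqM (q v) (just u) ∧ g u v)      ≡⟨ ∑-comm (λ v u → 𝟙 (eqM (q v) (just u) ∧ g u v)) ⟩
  ∑[ u < n ] ∑[ v < n ] 𝟙 (eqM (q v) (just u) ∧ g u v)      ≡⟨ sum-cong-≗ (λ u → sym (countB-sum (λ v → eqM (q v) (just u) ∧ g u v))) ⟩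
  ∑[ u < n ] countB (λ v → eqM (q v) (just u) ∧ g u v)      ∎
  where
  open ≡-Reasoning
  fibre : ∀ v (qv : Maybe (Fin n)) →
          𝟙 (maybe′ (λ u → g u v) false qv) ≡ ∑[ u < n ] 𝟙 (eqM qv (just u) ∧ g u v)
  fibre v nothing  = sym (sum-replicate-zero n)
  fibre v (just x) =
    sym (trans (sum-cong-≗ (λ u → cong (λ e → 𝟙 (e ∧ g u v)) (eqM-just x u))) (∑-delta x (λ u → g u v)))

∼-agree : ∀ {n} {F G : Parent n} → F ∼ G → ∀ {v x y} → F v ≡ just x → G v ≡ just y → x ≡ y
∼-agree F∼G {v} Fv Gv with F∼G v
... | inj₁ Fv≡Gv        = just-injective (trans (sym Fv) (trans Fv≡Gv Gv))
... | inj₂ (inj₁ Fv≡⊥) with () ← trans (sym Fv) Fv≡⊥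
... | inj₂ (inj₂ Gv≡⊥) with () ← trans (sym Gv) Gv≡⊥

mismatch : ∀ {n} → Permutation′ n → Parent n → Parent n → Fin n → Bool
mismatch σ p r v = not (eqM (r v) (Maybe.map (σ ⟨$⟩ʳ_) (p v)))

agreement : ∀ {n} {σ : Permutation′ n} {p r : Parent n} {v} →
            ¬ T (mismatch σ p r v) → r v ≡ Maybe.map (σ ⟨$⟩ʳ_) (p v)
agreement ¬mis = decidable-stable (≡-dec _≟_ _ _) (λ r≢σp → ¬mis (fromWitnessFalse r≢σp))

cut-mismatch : ∀ {n} (σ : Permutation′ n) (p r : Parent n) (x v : Fin n) →
               T (mismatch σ p r v) → T (mismatch σ (cutAt p x) r v) ⊎ T (eqF x v)
cut-mismatch σ p r x v mis with v ≟ x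
... | yes v≡x = inj₂ (fromWitness {a? = x ≟ v} (sym v≡x))
... | no  _   = inj₁ mis

permute-fixed : ∀ {n} (π : Permutation′ n) (p : Parent n) {v} →
                π ⟨$⟩ʳ v ≡ v → permute π p v ≡ Maybe.map (π ⟨$⟩ʳ_) (p v)
permute-fixed π p {v} fixed =
  cong (λ z → Maybe.map (π ⟨$⟩ʳ_) (p z)) (trans (cong (π ⟨$⟩ˡ_) (sym fixed)) (inverseˡ π))

permute-mismatch : ∀ {n} (σ π : Permutation′ n) (p r : Parent n) (v : Fin n) →
                   T (mismatch (π ∘ₚ σ) p r v) →
                   T (mismatch σ (permute π p) r v) ⊎ T (not (eqF (π ⟨$⟩ʳ v) v))
permute-mismatch σ π p r v mis with π ⟨$⟩ʳ v ≟ v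
... | no _      = inj₂ _
... | yes fixed = inj₁ (fromWitnessFalse λ agree → toWitnessFalse mis (begin
  r v                                                  ≡⟨ agree ⟩
  Maybe.map (σ ⟨$⟩ʳ_) (permute π p v)                  ≡⟨ cong (Maybe.map (σ ⟨$⟩ʳ_)) (permute-fixed π p fixed) ⟩
  Maybe.map (σ ⟨$⟩ʳ_) (Maybe.map (π ⟨$⟩ʳ_) (p v))     ≡⟨ sym (map-∘ (p v)) ⟩
  Maybe.map ((π ∘ₚ σ) ⟨$⟩ʳ_) (p v)                     ∎))
  where open ≡-Reasoning

reach-simulation : ∀ {n} {p r : Parent n} {s} → Reach p s r →
                   Σ[ σ ∈ Permutation′ n ] countB (mismatch σ p r) ≤ s
reach-simulation {n} {p} done = id , (begin
  countB (mismatch id p p)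
    ≤⟨ countB-mono {n} {f = mismatch id p p} {g = λ _ → false}
                   (λ v mis → toWitnessFalse mis (sym (map-id (p v)))) ⟩
  countB {n} (λ _ → false)  ≡⟨ countB-sum {n} (λ _ → false) ⟩
  ∑[ v < n ] 0              ≡⟨ sum-replicate-zero n ⟩
  0                         ∎)
  where open ≤-Reasoning
reach-simulation {n} {p} {r} (cut {s = s} x _ _ rest) with reach-simulation rest
... | σ , bound = σ , (begin
  countB (mismatch σ p r)                          ≤⟨ countB-cover (cut-mismatch σ p r x) ⟩
  countB (mismatch σ (cutAt p x) r) + countB (eqF x) ≤⟨ +-mono-≤ bound (≤-reflexive (countB-single x)) ⟩
  s + 1                                              ≡⟨ +-comm s 1 ⟩
  suc s                                              ∎)
  where open ≤-Reasoning
reach-simulation {n} {p} {r} (perm {s = s} π rest) with reach-simulation rest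
... | σ , bound = π ∘ₚ σ , (begin
  countB (mismatch (π ∘ₚ σ) p r)                          ≤⟨ countB-cover (permute-mismatch σ π p r) ⟩
  countB (mismatch σ (permute π p) r) + permCost π        ≤⟨ +-monoˡ-≤ (permCost π) bound ⟩
  s + permCost π                                          ≡⟨ +-comm s (permCost π) ⟩
  permCost π + s                                          ∎)
  where open ≤-Reasoning

otherParent : ∀ {n} → Fin n → Maybe (Fin n) → Bool
otherParent w (just x) = not (eqF x w)
otherParent w nothing  = false

cut3-by-parent : ∀ {n} (p b : Parent n) (m : Fin n → Fin n) (v : Fin n) →
                 cut3 p b m v ≡ maybe′ (λ u → otherParent (m u) (p v)) false (b v)
cut3-by-parent p b m v with b v | p v
... | nothing | _      = refl
... | just u  | nothing = refl
... | just u  | just w  = refl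

parent-split : ∀ {n} (c : Bool) (w : Fin n) (q : Maybe (Fin n)) →
               𝟙 (c ∧ otherParent w q) + 𝟙 (c ∧ eqM q (just w)) ≡ 𝟙 (c ∧ is-just q)
parent-split false w q        = refl
parent-split true  w nothing  = refl
parent-split true  w (just x) rewrite eqM-just x w with eqF x w
... | true  = refl
... | false = refl

is-just-witness : ∀ {A : Set} (q : Maybe A) → T (is-just q) → Σ[ x ∈ A ] q ≡ just x
is-just-witness (just x) _ = x , refl

module _ {n} (p b r : Parent n) (σ : Permutation′ n) (r∼b : r ∼ b) where

  -- A child v of u in F₂ whose p-parent w is not a mismatch has w = σ⁻¹(u):
  -- its r-parent σ(w) exists, so it is its F₂-parent u.
  agreeing-child : ∀ {u v w} → b v ≡ just u → p v ≡ just w → ¬ T (mismatch σ p r v) →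
                   w ≡ σ ⟨$⟩ˡ u
  agreeing-child {u} {v} {w} bv pv ¬mis =
    trans (sym (inverseˡ σ)) (cong (σ ⟨$⟩ˡ_) (∼-agree r∼b rv bv))
    where
    rv : r v ≡ just (σ ⟨$⟩ʳ w)
    rv = trans (agreement {σ = σ} {p} {r} ¬mis) (cong (Maybe.map (σ ⟨$⟩ʳ_)) pv)

  child-cover : ∀ u v → T (eqM (b v) (just u) ∧ is-just (p v)) →
                T (eqM (b v) (just u) ∧ eqM (p v) (just (σ ⟨$⟩ˡ u))) ⊎
                T (eqM (b v) (just u) ∧ mismatch σ p r v)
  child-cover u v hyp with Equivalence.to T-∧ hyp | T? (mismatch σ p r v)
  ... | child , _ | yes mis = inj₂ (Equivalence.from T-∧ (child , mis))
  ... | child , hasParent | no ¬mis with is-just-witness (p v) hasParent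
  ...   | _ , pv = inj₁ (Equivalence.from T-∧ (child , fromWitness {a? = ≡-dec _≟_ (p v) (just (σ ⟨$⟩ˡ u))}
                     (trans pv (cong just (agreeing-child bv pv ¬mis)))))
    where
    bv : b v ≡ just u
    bv = toWitness {a? = ≡-dec _≟_ (b v) (just u)} child

  step3-cuts-at : (m : Fin n → Fin n) → IsMode3 p b m → ∀ u →
                  countB (λ v → eqM (b v) (just u) ∧ otherParent (m u) (p v)) ≤
                  countB (λ v → eqM (b v) (just u) ∧ mismatch σ p r v)
  step3-cuts-at m mode u = +-cancelʳ-≤ (cnt3 p b u (m u)) cuts mismatched (begin
    cuts + cnt3 p b u (m u)
      ≡⟨ countB-disjoint (λ v → parent-split (eqM (b v) (just u)) (m u) (p v)) ⟩
    countB (λ v → eqM (b v) (just u) ∧ is-just (p v))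
      ≤⟨ countB-cover (child-cover u) ⟩
    cnt3 p b u (σ ⟨$⟩ˡ u) + mismatched
      ≤⟨ +-monoˡ-≤ mismatched (mode u (σ ⟨$⟩ˡ u)) ⟩
    cnt3 p b u (m u) + mismatched
      ≡⟨ +-comm (cnt3 p b u (m u)) mismatched ⟩
    mismatched + cnt3 p b u (m u) ∎)
    where
    open ≤-Reasoning
    cuts mismatched : ℕ
    cuts       = countB (λ v → eqM (b v) (just u) ∧ otherParent (m u) (p v))
    mismatched = countB (λ v → eqM (b v) (just u) ∧ mismatch σ p r v)

step3-cuts-≤-size : ∀ {n} (p b : Parent n) (m : Fin n → Fin n) → IsMode3 p b m →
                    ∀ {s r} → Reach p s r → r ∼ b → ALG3 p b m ≤ s
step3-cuts-≤-size {n} p b m mode {s} {r} reach r∼b with reach-simulation reach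
... | σ , bound = begin
  ALG3 p b m
    ≡⟨ countB-cong (cut3-by-parent p b m) ⟩
  countB (λ v → maybe′ (λ u → otherParent (m u) (p v)) false (b v))
    ≡⟨ countB-fibres b (λ u v → otherParent (m u) (p v)) ⟩
  ∑[ u < n ] countB (λ v → eqM (b v) (just u) ∧ otherParent (m u) (p v))
    ≤⟨ ∑-mono (step3-cuts-at p b r σ r∼b m mode) ⟩
  ∑[ u < n ] countB (λ v → eqM (b v) (just u) ∧ mismatch σ p r v)
    ≡⟨ sym (countB-fibres b (λ _ v → mismatch σ p r v)) ⟩
  countB (λ v → maybe′ (λ _ → mismatch σ p r v) false (b v))
    ≤⟨ countB-mono (λ v → has-parent-and (b v)) ⟩
  countB (mismatch σ p r)
    ≤⟨ bound ⟩
  s ∎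
  where
  open ≤-Reasoning
  has-parent-and : ∀ {x} (q : Maybe (Fin n)) → T (maybe′ (λ _ → x) false q) → T x
  has-parent-and (just _) holds = holds

lemma18 : (n : ℕ) (F₁ F₂ : Parent n) → IsForest F₁ → IsForest F₂ →
          (m₂ : Fin n → Fin n) → IsMode2 (step1 F₁ F₂) F₂ m₂ →
          (m₃ : Fin n → Fin n) → IsMode3 (F1² F₁ F₂ m₂) F₂ m₃ →
          (d : ℕ) → IsDtilde (F1² F₁ F₂ m₂) F₂ d →
          ALG3 (F1² F₁ F₂ m₂) F₂ m₃ ≤ 2 * d
lemma18 n F₁ F₂ _ _ m₂ _ m₃ mode₃ d ((F' , reach , F'∼F₂) , _) =
  ≤-trans (step3-cuts-≤-size (F1² F₁ F₂ m₂) F₂ m₃ mode₃ reach F'∼F₂) (m≤m+n d (d + 0))
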